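{- Let $p(t)=(-1+2t+2t^2)/3$ and for $k\ge0$ define $C_{i,k}$ by $\frac{(tp(t))^k}{1-t^3}=\sum_{i\ge0}C_{i,k}t^i$. Let $$V_{p(t)}=\begin{pmatrix}2/3 & 2/3 & -1/3\\ -1/3 & 2/3 & 2/3\\ 2/3 & -1/3 & 2/3\end{pmatrix}$$ be the circulant matrix associated to $p(t)$. Then $V_{p(t)}$ has order $6$, and for each $k\in\{1,2,\dots,6\}$ and every $n\in\mathbb N$, $$\sum_{i=0}^{3(k-1)}C_{i,k}=\sum_{i=0}^{3(k+6n-1)}C_{i,k+6n}.$$
   Context: $C_{i,k}$ is the entry in row $i$, column $k$ (indexed from $0$) of the Riordan array $\bigl(1/(1-t^3),\,tp(t)\bigr)$. The circulant matrix associated to $p(t)=a_0+a_1t+a_2t^2$ has rows $(a_2,a_1,a_0)$, $(a_0,a_2,a_1)$, $(a_1,a_0,a_2)$. -}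

module Defs where

open import Data.Nat as ℕ using (ℕ; zero; suc; _∸_; _≤_; _<_)
open import Data.Nat.Divisibility using (_∣?_)
open import Data.Integer using (+_; -[1+_])
open import Data.Rational using (ℚ; _+_; _*_; _/_; 0ℚ; 1ℚ)
open import Data.Fin using (Fin; zero; suc)
open import Relation.Nullary.Decidable using (does)
open import Data.Bool using (if_then_else_)
open import Relation.Binary.PropositionalEquality using (_≡_)
open import Data.Product using (_×_)
open import Relation.Nullary using (¬_)

Series : Set
Series = ℕ → ℚ

sumTo : ℕ → (ℕ → ℚ) → ℚ
sumTo zero    f = f 0
sumTo (suc n) f = sumTo n f + f (suc n)

_⊛_ : Series → Series → Series
(f ⊛ g) n = sumTo n (λ j → f j * g (n ∸ j))

pow : Series → ℕ → Series
pow f zero    = λ { zero → 1ℚ ; (suc _) → 0ℚ }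
pow f (suc k) = f ⊛ pow f k

a0 a1 a2 : ℚ
a0 = -[1+ 0 ] / 3
a1 = + 2 / 3
a2 = + 2 / 3

p : Series
p 0 = a0
p 1 = a1
p 2 = a2
p _ = 0ℚ

tp : Series
tp zero    = 0ℚ
tp (suc i) = p i

-- 1/(1 - t^3) = Σ_m t^(3m)
geom3 : Series
geom3 i = if does (3 ∣? i) then 1ℚ else 0ℚ

C : ℕ → ℕ → ℚ
C i k = (geom3 ⊛ pow tp k) i

Mat : Set
Mat = Fin 3 → Fin 3 → ℚ

sum3 : (Fin 3 → ℚ) → ℚ
sum3 f = f zero + f (suc zero) + f (suc (suc zero))

_·_ : Mat → Mat → Mat
(A · B) i j = sum3 (λ l → A i l * B l j)

I₃ : Mat
I₃ i j = δ i j
  where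
  δ : ∀ {n} → Fin n → Fin n → ℚ
  δ zero zero = 1ℚ
  δ (suc a) (suc b) = δ a b
  δ _ _ = 0ℚ

matPow : Mat → ℕ → Mat
matPow A zero    = I₃
matPow A (suc k) = A · matPow A k

_≐_ : Mat → Mat → Set
A ≐ B = ∀ i j → A i j ≡ B i j

circulant : ℚ → ℚ → ℚ → Mat
circulant b0 b1 b2 zero zero = b2
circulant b0 b1 b2 zero (suc zero) = b1
circulant b0 b1 b2 zero (suc (suc zero)) = b0
circulant b0 b1 b2 (suc zero) zero = b0
circulant b0 b1 b2 (suc zero) (suc zero) = b2
circulant b0 b1 b2 (suc zero) (suc (suc zero)) = b1
circulant b0 b1 b2 (suc (suc zero)) zero = b1
circulant b0 b1 b2 (suc (suc zero)) (suc zero) = b0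
circulant b0 b1 b2 (suc (suc zero)) (suc (suc zero)) = b2

V : Mat
V = circulant a0 a1 a2

HasOrder : Mat → ℕ → Set
HasOrder A m = (0 < m) × (matPow A m ≐ I₃) × (∀ j → 0 < j → j < m → ¬ (matPow A j ≐ I₃))

{-# OPTIONS --safe #-}
-- Since 1/(1 - t³) and t p(t) commute, column k + 1 of the Riordan array is
-- t p(t) times column k.  Multiplying by t p(t) acts on coefficients through
-- the three-term recurrence f ↦ a0 f(n+2) + a1 f(n+1) + a2 f(n), which passes
-- to partial sums.  Because p(1) = 1, every window of three consecutive entries
-- of column k + 1 beyond row 3k sums to 1.  Hence the triple of partial sums of
-- column m + 1 up to rows 3m, 3m + 1, 3m + 2 evolves under an affine map with
-- linear part V, whose sixth iterate fixes the initial triple: the orbit, and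
-- with it the sum in the theorem, is periodic of period 6.
module Submission where

open import Defs
open import Data.Nat using (ℕ; _+_; _*_; _∸_; _≤_)
open import Data.Product using (_×_)
open import Relation.Binary.PropositionalEquality using (_≡_)

open import Data.Nat using (zero; suc; z≤n; s≤s; _<_)
open import Data.Nat.Properties using (*-suc; *-comm; m≤n⇒m≤1+n; m≤n⇒m≤o+n; ≤-refl; n≤1+n)
open import Data.Nat.GeneralisedArithmetic using (fold; fold-+)
open import Data.Rational as ℚ using (ℚ; 0ℚ; 1ℚ)
open import Data.Rational.Properties using (*-zeroˡ; +-identityʳ)
open import Data.Rational.Solver using (module +-*-Solver)
open +-*-Solver using (solve; _:+_; _:*_; _:=_; con)
open import Data.Fin using (zero; suc)
open import Data.Product using (_,_; proj₁)
open import Relation.Binary.PropositionalEquality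
  using (refl; sym; trans; cong; cong₂; subst; module ≡-Reasoning)
open import Relation.Nullary using (¬_)

open ≡-Reasoning

sumTo-cong : ∀ n {f g : ℕ → ℚ} → (∀ j → f j ≡ g j) → sumTo n f ≡ sumTo n g
sumTo-cong zero    f≗g = f≗g 0
sumTo-cong (suc n) f≗g = cong₂ ℚ._+_ (sumTo-cong n f≗g) (f≗g (suc n))

sumTo-head : ∀ n (f : ℕ → ℚ) → sumTo (suc n) f ≡ f 0 ℚ.+ sumTo n (λ j → f (suc j))
sumTo-head zero    f = refl
sumTo-head (suc n) f = begin
  sumTo (suc n) f ℚ.+ f (2 + n)
    ≡⟨ cong (ℚ._+ f (2 + n)) (sumTo-head n f) ⟩
  f 0 ℚ.+ sumTo n (λ j → f (suc j)) ℚ.+ f (2 + n)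
    ≡⟨ solve 3 (λ x s y → x :+ s :+ y := x :+ (s :+ y)) refl
         (f 0) (sumTo n (λ j → f (suc j))) (f (2 + n)) ⟩
  f 0 ℚ.+ (sumTo n (λ j → f (suc j)) ℚ.+ f (2 + n)) ∎

window3 : (ℕ → ℚ) → ℕ → ℚ
window3 f N = f (1 + N) ℚ.+ f (2 + N) ℚ.+ f (3 + N)

window3-cong : ∀ {f g : ℕ → ℚ} → (∀ j → f j ≡ g j) → ∀ N → window3 f N ≡ window3 g N
window3-cong f≗g N = cong₂ ℚ._+_ (cong₂ ℚ._+_ (f≗g (1 + N)) (f≗g (2 + N))) (f≗g (3 + N))

sumTo-+3 : ∀ (f : ℕ → ℚ) N → sumTo (3 + N) f ≡ sumTo N f ℚ.+ window3 f N
sumTo-+3 f N = solve 4 (λ s x y z → s :+ x :+ y :+ z := s :+ (x :+ y :+ z)) refl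
  (sumTo N f) (f (1 + N)) (f (2 + N)) (f (3 + N))

-- The coefficient of t^(n+3) in t p(t) f(t), given those of t^(n+2), t^(n+1), t^n in f(t).
pcomb : ℚ → ℚ → ℚ → ℚ
pcomb x y z = a0 ℚ.* x ℚ.+ a1 ℚ.* y ℚ.+ a2 ℚ.* z

pcomb-cong : ∀ {x y z x′ y′ z′} → x ≡ x′ → y ≡ y′ → z ≡ z′ →
             pcomb x y z ≡ pcomb x′ y′ z′
pcomb-cong refl refl refl = refl

pcomb-+ : ∀ x y z x′ y′ z′ →
          pcomb x y z ℚ.+ pcomb x′ y′ z′ ≡ pcomb (x ℚ.+ x′) (y ℚ.+ y′) (z ℚ.+ z′)
pcomb-+ = solve 6 (λ x y z x′ y′ z′ →
  con a0 :* x :+ con a1 :* y :+ con a2 :* z :+ (con a0 :* x′ :+ con a1 :* y′ :+ con a2 :* z′)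
    := con a0 :* (x :+ x′) :+ con a1 :* (y :+ y′) :+ con a2 :* (z :+ z′)) refl

p-at-1 : pcomb 1ℚ 1ℚ 1ℚ ≡ 1ℚ
p-at-1 = refl

sumTo-p-weighted : ∀ m (h : ℕ → ℚ) → sumTo (2 + m) (λ j → p j ℚ.* h j) ≡ pcomb (h 0) (h 1) (h 2)
sumTo-p-weighted zero    h = refl
sumTo-p-weighted (suc m) h = begin
  sumTo (2 + m) (λ j → p j ℚ.* h j) ℚ.+ 0ℚ ℚ.* h (3 + m)
    ≡⟨ cong₂ ℚ._+_ (sumTo-p-weighted m h) (*-zeroˡ (h (3 + m))) ⟩
  pcomb (h 0) (h 1) (h 2) ℚ.+ 0ℚ
    ≡⟨ +-identityʳ _ ⟩
  pcomb (h 0) (h 1) (h 2) ∎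

tp⊛-0 : ∀ f → (tp ⊛ f) 0 ≡ 0ℚ
tp⊛-0 f = *-zeroˡ (f 0)

tp⊛-1 : ∀ f → (tp ⊛ f) 1 ≡ a0 ℚ.* f 0
tp⊛-1 f = solve 2 (λ x y → con 0ℚ :* x :+ con a0 :* y := con a0 :* y) refl (f 1) (f 0)

tp⊛-2 : ∀ f → (tp ⊛ f) 2 ≡ a0 ℚ.* f 1 ℚ.+ a1 ℚ.* f 0
tp⊛-2 f = solve 3 (λ x y z → con 0ℚ :* x :+ con a0 :* y :+ con a1 :* z := con a0 :* y :+ con a1 :* z)
  refl (f 2) (f 1) (f 0)

tp⊛-3+ : ∀ f n → (tp ⊛ f) (3 + n) ≡ pcomb (f (2 + n)) (f (1 + n)) (f n)
tp⊛-3+ f n = begin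
  (tp ⊛ f) (3 + n)
    ≡⟨ sumTo-head (2 + n) (λ j → tp j ℚ.* f (3 + n ∸ j)) ⟩
  0ℚ ℚ.* f (3 + n) ℚ.+ sumTo (2 + n) (λ j → p j ℚ.* f (2 + n ∸ j))
    ≡⟨ cong₂ ℚ._+_ (*-zeroˡ (f (3 + n))) (sumTo-p-weighted n (λ j → f (2 + n ∸ j))) ⟩
  0ℚ ℚ.+ pcomb (f (2 + n)) (f (1 + n)) (f n)
    ≡⟨ solve 1 (λ x → con 0ℚ :+ x := x) refl _ ⟩
  pcomb (f (2 + n)) (f (1 + n)) (f n) ∎

geom3⊛-0 : ∀ f → (geom3 ⊛ f) 0 ≡ f 0
geom3⊛-0 f = solve 1 (λ x → con 1ℚ :* x := x) refl (f 0)

geom3⊛-1 : ∀ f → (geom3 ⊛ f) 1 ≡ f 1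
geom3⊛-1 f = solve 2 (λ x y → con 1ℚ :* x :+ con 0ℚ :* y := x) refl (f 1) (f 0)

geom3⊛-2 : ∀ f → (geom3 ⊛ f) 2 ≡ f 2
geom3⊛-2 f = solve 3 (λ x y z → con 1ℚ :* x :+ con 0ℚ :* y :+ con 0ℚ :* z := x) refl (f 2) (f 1) (f 0)

-- geom3 (3 + j) reduces to geom3 j, so the tail of the sum is (geom3 ⊛ f) i itself.
geom3⊛-3+ : ∀ f i → (geom3 ⊛ f) (3 + i) ≡ (geom3 ⊛ f) i ℚ.+ f (3 + i)
geom3⊛-3+ f i = begin
  (geom3 ⊛ f) (3 + i)
    ≡⟨ sumTo-head (2 + i) _ ⟩
  1ℚ ℚ.* f (3 + i) ℚ.+ sumTo (2 + i) (λ j → geom3 (1 + j) ℚ.* f (2 + i ∸ j))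
    ≡⟨ cong (1ℚ ℚ.* f (3 + i) ℚ.+_) (sumTo-head (1 + i) _) ⟩
  1ℚ ℚ.* f (3 + i) ℚ.+ (0ℚ ℚ.* f (2 + i) ℚ.+ sumTo (1 + i) (λ j → geom3 (2 + j) ℚ.* f (1 + i ∸ j)))
    ≡⟨ cong (λ s → 1ℚ ℚ.* f (3 + i) ℚ.+ (0ℚ ℚ.* f (2 + i) ℚ.+ s)) (sumTo-head i _) ⟩
  1ℚ ℚ.* f (3 + i) ℚ.+ (0ℚ ℚ.* f (2 + i) ℚ.+ (0ℚ ℚ.* f (1 + i) ℚ.+ (geom3 ⊛ f) i))
    ≡⟨ solve 4 (λ x y z s → con 1ℚ :* x :+ (con 0ℚ :* y :+ (con 0ℚ :* z :+ s)) := s :+ x)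
         refl (f (3 + i)) (f (2 + i)) (f (1 + i)) ((geom3 ⊛ f) i) ⟩
  (geom3 ⊛ f) i ℚ.+ f (3 + i) ∎

tp⊛geom3⊛-1 : ∀ f → (tp ⊛ (geom3 ⊛ f)) 1 ≡ a0 ℚ.* f 0
tp⊛geom3⊛-1 f = trans (tp⊛-1 (geom3 ⊛ f)) (cong (a0 ℚ.*_) (geom3⊛-0 f))

tp⊛geom3⊛-2 : ∀ f → (tp ⊛ (geom3 ⊛ f)) 2 ≡ a0 ℚ.* f 1 ℚ.+ a1 ℚ.* f 0
tp⊛geom3⊛-2 f =
  trans (tp⊛-2 (geom3 ⊛ f)) (cong₂ (λ x y → a0 ℚ.* x ℚ.+ a1 ℚ.* y) (geom3⊛-1 f) (geom3⊛-0 f))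

tp⊛geom3⊛-3+ : ∀ f n → (tp ⊛ (geom3 ⊛ f)) (3 + n) ≡ (tp ⊛ (geom3 ⊛ f)) n ℚ.+ (tp ⊛ f) (3 + n)
tp⊛geom3⊛-3+ f 0 = begin
  (tp ⊛ g) 3                     ≡⟨ tp⊛-3+ g 0 ⟩
  pcomb (g 2) (g 1) (g 0)                ≡⟨ pcomb-cong (geom3⊛-2 f) (geom3⊛-1 f) (geom3⊛-0 f) ⟩
  pcomb (f 2) (f 1) (f 0)                ≡⟨ solve 1 (λ x → x := con 0ℚ :+ x) refl _ ⟩
  0ℚ ℚ.+ pcomb (f 2) (f 1) (f 0)         ≡⟨ sym (cong₂ ℚ._+_ (tp⊛-0 g) (tp⊛-3+ f 0)) ⟩
  (tp ⊛ g) 0 ℚ.+ (tp ⊛ f) 3 ∎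
  where g = geom3 ⊛ f
tp⊛geom3⊛-3+ f 1 = begin
  (tp ⊛ g) 4                     ≡⟨ tp⊛-3+ g 1 ⟩
  pcomb (g 3) (g 2) (g 1)
    ≡⟨ pcomb-cong (trans (geom3⊛-3+ f 0) (cong (ℚ._+ f 3) (geom3⊛-0 f))) (geom3⊛-2 f) (geom3⊛-1 f) ⟩
  pcomb (f 0 ℚ.+ f 3) (f 2) (f 1)
    ≡⟨ solve 4 (λ x₀ x₁ x₂ x₃ → con a0 :* (x₀ :+ x₃) :+ con a1 :* x₂ :+ con a2 :* x₁
         := con a0 :* x₀ :+ (con a0 :* x₃ :+ con a1 :* x₂ :+ con a2 :* x₁)) refl (f 0) (f 1) (f 2) (f 3) ⟩
  a0 ℚ.* f 0 ℚ.+ pcomb (f 3) (f 2) (f 1)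
    ≡⟨ sym (cong₂ ℚ._+_ (tp⊛geom3⊛-1 f) (tp⊛-3+ f 1)) ⟩
  (tp ⊛ g) 1 ℚ.+ (tp ⊛ f) 4 ∎
  where g = geom3 ⊛ f
tp⊛geom3⊛-3+ f 2 = begin
  (tp ⊛ g) 5                     ≡⟨ tp⊛-3+ g 2 ⟩
  pcomb (g 4) (g 3) (g 2)
    ≡⟨ pcomb-cong (trans (geom3⊛-3+ f 1) (cong (ℚ._+ f 4) (geom3⊛-1 f)))
                  (trans (geom3⊛-3+ f 0) (cong (ℚ._+ f 3) (geom3⊛-0 f))) (geom3⊛-2 f) ⟩
  pcomb (f 1 ℚ.+ f 4) (f 0 ℚ.+ f 3) (f 2)
    ≡⟨ solve 5 (λ x₀ x₁ x₂ x₃ x₄ →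
         con a0 :* (x₁ :+ x₄) :+ con a1 :* (x₀ :+ x₃) :+ con a2 :* x₂
         := con a0 :* x₁ :+ con a1 :* x₀ :+ (con a0 :* x₄ :+ con a1 :* x₃ :+ con a2 :* x₂))
         refl (f 0) (f 1) (f 2) (f 3) (f 4) ⟩
  a0 ℚ.* f 1 ℚ.+ a1 ℚ.* f 0 ℚ.+ pcomb (f 4) (f 3) (f 2)
    ≡⟨ sym (cong₂ ℚ._+_ (tp⊛geom3⊛-2 f) (tp⊛-3+ f 2)) ⟩
  (tp ⊛ g) 2 ℚ.+ (tp ⊛ f) 5 ∎
  where g = geom3 ⊛ f
tp⊛geom3⊛-3+ f (suc (suc (suc n))) = begin
  (tp ⊛ g) (6 + n)
    ≡⟨ tp⊛-3+ g (3 + n) ⟩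
  pcomb (g (5 + n)) (g (4 + n)) (g (3 + n))
    ≡⟨ pcomb-cong (geom3⊛-3+ f (2 + n)) (geom3⊛-3+ f (1 + n)) (geom3⊛-3+ f n) ⟩
  pcomb (g (2 + n) ℚ.+ f (5 + n)) (g (1 + n) ℚ.+ f (4 + n)) (g n ℚ.+ f (3 + n))
    ≡⟨ sym (pcomb-+ (g (2 + n)) (g (1 + n)) (g n) (f (5 + n)) (f (4 + n)) (f (3 + n))) ⟩
  pcomb (g (2 + n)) (g (1 + n)) (g n) ℚ.+ pcomb (f (5 + n)) (f (4 + n)) (f (3 + n))
    ≡⟨ sym (cong₂ ℚ._+_ (tp⊛-3+ g n) (tp⊛-3+ f (3 + n))) ⟩
  (tp ⊛ g) (3 + n) ℚ.+ (tp ⊛ f) (6 + n) ∎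
  where g = geom3 ⊛ f

geom3⊛tp⊛-comm : ∀ f i → (geom3 ⊛ (tp ⊛ f)) i ≡ (tp ⊛ (geom3 ⊛ f)) i
geom3⊛tp⊛-comm f 0 = trans (geom3⊛-0 (tp ⊛ f)) (trans (tp⊛-0 f) (sym (tp⊛-0 (geom3 ⊛ f))))
geom3⊛tp⊛-comm f 1 = begin
  (geom3 ⊛ (tp ⊛ f)) 1       ≡⟨ trans (geom3⊛-1 (tp ⊛ f)) (tp⊛-1 f) ⟩
  a0 ℚ.* f 0                 ≡⟨ sym (tp⊛geom3⊛-1 f) ⟩
  (tp ⊛ (geom3 ⊛ f)) 1 ∎
geom3⊛tp⊛-comm f 2 = begin
  (geom3 ⊛ (tp ⊛ f)) 2       ≡⟨ trans (geom3⊛-2 (tp ⊛ f)) (tp⊛-2 f) ⟩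
  a0 ℚ.* f 1 ℚ.+ a1 ℚ.* f 0  ≡⟨ sym (tp⊛geom3⊛-2 f) ⟩
  (tp ⊛ (geom3 ⊛ f)) 2 ∎
geom3⊛tp⊛-comm f (suc (suc (suc n))) = begin
  (geom3 ⊛ (tp ⊛ f)) (3 + n)                    ≡⟨ geom3⊛-3+ (tp ⊛ f) n ⟩
  (geom3 ⊛ (tp ⊛ f)) n ℚ.+ (tp ⊛ f) (3 + n)
    ≡⟨ cong (ℚ._+ (tp ⊛ f) (3 + n)) (geom3⊛tp⊛-comm f n) ⟩
  (tp ⊛ (geom3 ⊛ f)) n ℚ.+ (tp ⊛ f) (3 + n)     ≡⟨ sym (tp⊛geom3⊛-3+ f n) ⟩
  (tp ⊛ (geom3 ⊛ f)) (3 + n) ∎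

sumTo-tp⊛ : ∀ f N → sumTo (3 + N) (tp ⊛ f) ≡ pcomb (sumTo (2 + N) f) (sumTo (1 + N) f) (sumTo N f)
sumTo-tp⊛ f zero = begin
  (tp ⊛ f) 0 ℚ.+ (tp ⊛ f) 1 ℚ.+ (tp ⊛ f) 2 ℚ.+ (tp ⊛ f) 3
    ≡⟨ cong₂ ℚ._+_ (cong₂ ℚ._+_ (cong₂ ℚ._+_ (tp⊛-0 f) (tp⊛-1 f)) (tp⊛-2 f)) (tp⊛-3+ f 0) ⟩
  0ℚ ℚ.+ a0 ℚ.* f 0 ℚ.+ (a0 ℚ.* f 1 ℚ.+ a1 ℚ.* f 0) ℚ.+ pcomb (f 2) (f 1) (f 0)
    ≡⟨ solve 3 (λ x₀ x₁ x₂ →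
         con 0ℚ :+ con a0 :* x₀ :+ (con a0 :* x₁ :+ con a1 :* x₀)
           :+ (con a0 :* x₂ :+ con a1 :* x₁ :+ con a2 :* x₀)
           := con a0 :* (x₀ :+ x₁ :+ x₂) :+ con a1 :* (x₀ :+ x₁) :+ con a2 :* x₀) refl (f 0) (f 1) (f 2) ⟩
  pcomb (sumTo 2 f) (sumTo 1 f) (sumTo 0 f) ∎
sumTo-tp⊛ f (suc N) = begin
  sumTo (3 + N) (tp ⊛ f) ℚ.+ (tp ⊛ f) (4 + N)
    ≡⟨ cong₂ ℚ._+_ (sumTo-tp⊛ f N) (tp⊛-3+ f (1 + N)) ⟩
  pcomb (sumTo (2 + N) f) (sumTo (1 + N) f) (sumTo N f) ℚ.+ pcomb (f (3 + N)) (f (2 + N)) (f (1 + N))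
    ≡⟨ pcomb-+ (sumTo (2 + N) f) (sumTo (1 + N) f) (sumTo N f) (f (3 + N)) (f (2 + N)) (f (1 + N)) ⟩
  pcomb (sumTo (3 + N) f) (sumTo (2 + N) f) (sumTo (1 + N) f) ∎

window3-tp⊛ : ∀ f N →
  window3 (tp ⊛ f) (3 + N) ≡ pcomb (window3 f (2 + N)) (window3 f (1 + N)) (window3 f N)
window3-tp⊛ f N = begin
  window3 (tp ⊛ f) (3 + N)
    ≡⟨ cong₂ ℚ._+_ (cong₂ ℚ._+_ (tp⊛-3+ f (1 + N)) (tp⊛-3+ f (2 + N))) (tp⊛-3+ f (3 + N)) ⟩
  pcomb (f (3 + N)) (f (2 + N)) (f (1 + N)) ℚ.+ pcomb (f (4 + N)) (f (3 + N)) (f (2 + N))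
    ℚ.+ pcomb (f (5 + N)) (f (4 + N)) (f (3 + N))
    ≡⟨ cong (ℚ._+ pcomb (f (5 + N)) (f (4 + N)) (f (3 + N)))
         (pcomb-+ (f (3 + N)) (f (2 + N)) (f (1 + N)) (f (4 + N)) (f (3 + N)) (f (2 + N))) ⟩
  pcomb (f (3 + N) ℚ.+ f (4 + N)) (f (2 + N) ℚ.+ f (3 + N)) (f (1 + N) ℚ.+ f (2 + N))
    ℚ.+ pcomb (f (5 + N)) (f (4 + N)) (f (3 + N))
    ≡⟨ pcomb-+ (f (3 + N) ℚ.+ f (4 + N)) (f (2 + N) ℚ.+ f (3 + N)) (f (1 + N) ℚ.+ f (2 + N))
               (f (5 + N)) (f (4 + N)) (f (3 + N)) ⟩
  pcomb (window3 f (2 + N)) (window3 f (1 + N)) (window3 f N) ∎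

column : ℕ → ℕ → ℚ
column k i = C i k

column-suc : ∀ k i → column (suc k) i ≡ (tp ⊛ column k) i
column-suc k = geom3⊛tp⊛-comm (pow tp k)

column₀-periodic : ∀ i → column 0 (3 + i) ≡ column 0 i
column₀-periodic i = trans (geom3⊛-3+ (pow tp 0) i) (+-identityʳ (column 0 i))

window3-column₀ : ∀ N → window3 (column 0) N ≡ 1ℚ
window3-column₀ 0 = refl
window3-column₀ 1 = refl
window3-column₀ 2 = refl
window3-column₀ (suc (suc (suc N))) =
  trans (window3-cong {λ j → column 0 (3 + j)} column₀-periodic N) (window3-column₀ N)

window3-column-suc : ∀ k N → window3 (column k) (2 + N) ≡ 1ℚ → window3 (column k) (1 + N) ≡ 1ℚ →
  window3 (column k) N ≡ 1ℚ → window3 (column (suc k)) (3 + N) ≡ 1ℚ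
window3-column-suc k N w₂ w₁ w₀ = begin
  window3 (column (suc k)) (3 + N)
    ≡⟨ window3-cong (column-suc k) (3 + N) ⟩
  window3 (tp ⊛ column k) (3 + N)
    ≡⟨ window3-tp⊛ (column k) N ⟩
  pcomb (window3 (column k) (2 + N)) (window3 (column k) (1 + N)) (window3 (column k) N)
    ≡⟨ pcomb-cong w₂ w₁ w₀ ⟩
  pcomb 1ℚ 1ℚ 1ℚ
    ≡⟨ p-at-1 ⟩
  1ℚ ∎

window3-column : ∀ k N → 3 * k ≤ N → window3 (column (suc k)) N ≡ 1ℚ
window3-column zero 0 _ = refl
window3-column zero 1 _ = refl
window3-column zero 2 _ = refl
window3-column zero (suc (suc (suc N))) _ =
  window3-column-suc 0 N (window3-column₀ (2 + N)) (window3-column₀ (1 + N)) (window3-column₀ N)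
window3-column (suc k) N 3[1+k]≤N = from-3+ N (subst (_≤ N) (*-suc 3 k) 3[1+k]≤N)
  where
  from-3+ : ∀ N → 3 + 3 * k ≤ N → window3 (column (2 + k)) N ≡ 1ℚ
  from-3+ (suc (suc (suc N))) (s≤s (s≤s (s≤s 3k≤N))) = window3-column-suc (suc k) N
    (window3-column k (2 + N) (m≤n⇒m≤o+n 2 3k≤N))
    (window3-column k (1 + N) (m≤n⇒m≤1+n 3k≤N))
    (window3-column k N 3k≤N)

columnSum : ℕ → ℕ → ℚ
columnSum k N = sumTo N (column k)

columnSum-suc : ∀ k N →
  columnSum (suc k) (3 + N) ≡ pcomb (columnSum k (2 + N)) (columnSum k (1 + N)) (columnSum k N)
columnSum-suc k N = trans (sumTo-cong (3 + N) (column-suc k)) (sumTo-tp⊛ (column k) N)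

columnSum-+3 : ∀ k N → 3 * k ≤ N → columnSum (suc k) (3 + N) ≡ columnSum (suc k) N ℚ.+ 1ℚ
columnSum-+3 k N 3k≤N =
  trans (sumTo-+3 (column (suc k)) N) (cong (columnSum (suc k) N ℚ.+_) (window3-column k N 3k≤N))

-- Φ t = V t + (0, a0, a0 + a1), with V the circulant matrix of p.
Φ : ℚ × ℚ × ℚ → ℚ × ℚ × ℚ
Φ (u , v , w) = pcomb w v u , pcomb (u ℚ.+ 1ℚ) w v , pcomb (v ℚ.+ 1ℚ) (u ℚ.+ 1ℚ) w

orbit : ℕ → ℚ × ℚ × ℚ
orbit m = columnSum (suc m) (3 * m) , columnSum (suc m) (1 + 3 * m) , columnSum (suc m) (2 + 3 * m)

orbit-suc : ∀ m → orbit (suc m) ≡ Φ (orbit m)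
orbit-suc m = begin
  orbit (suc m)
    ≡⟨ cong (λ N → columnSum (2 + m) N , columnSum (2 + m) (1 + N) , columnSum (2 + m) (2 + N)) (*-suc 3 m) ⟩
  columnSum (2 + m) (3 + 3 * m) , columnSum (2 + m) (4 + 3 * m) , columnSum (2 + m) (5 + 3 * m)
    ≡⟨ cong₂ _,_ (columnSum-suc (suc m) (3 * m)) (cong₂ _,_
         (trans (columnSum-suc (suc m) (1 + 3 * m)) (cong (λ x → pcomb x w v) sum₃))
         (trans (columnSum-suc (suc m) (2 + 3 * m)) (cong₂ (λ x y → pcomb x y w) sum₄ sum₃))) ⟩
  Φ (orbit m) ∎
  where
  v = columnSum (suc m) (1 + 3 * m)
  w = columnSum (suc m) (2 + 3 * m)
  sum₃ : columnSum (suc m) (3 + 3 * m) ≡ columnSum (suc m) (3 * m) ℚ.+ 1ℚ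
  sum₃ = columnSum-+3 m (3 * m) ≤-refl
  sum₄ : columnSum (suc m) (4 + 3 * m) ≡ columnSum (suc m) (1 + 3 * m) ℚ.+ 1ℚ
  sum₄ = columnSum-+3 m (1 + 3 * m) (n≤1+n (3 * m))

orbit₀-period-6 : fold (orbit 0) Φ 6 ≡ orbit 0
orbit₀-period-6 = refl

fold-periodic : ∀ {A : Set} (f : A → A) (z : A) p → fold z f p ≡ z →
                ∀ m n → fold z f (m + n * p) ≡ fold z f m
fold-periodic f z p fᵖz≡z m n = trans (fold-+ z f m) (cong (λ y → fold y f m) (fold-multiple n))
  where
  fold-multiple : ∀ n → fold z f (n * p) ≡ z
  fold-multiple zero    = refl
  fold-multiple (suc n) = trans (fold-+ z f p) (trans (cong (λ y → fold y f p) (fold-multiple n)) fᵖz≡z)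

orbit-periodic : ∀ m n → orbit (m + 6 * n) ≡ orbit m
orbit-periodic m n = begin
  orbit (m + 6 * n)            ≡⟨ orbit-fold (m + 6 * n) ⟩
  fold (orbit 0) Φ (m + 6 * n) ≡⟨ cong (λ j → fold (orbit 0) Φ (m + j)) (*-comm 6 n) ⟩
  fold (orbit 0) Φ (m + n * 6) ≡⟨ fold-periodic Φ (orbit 0) 6 orbit₀-period-6 m n ⟩
  fold (orbit 0) Φ m           ≡⟨ sym (orbit-fold m) ⟩
  orbit m ∎
  where
  orbit-fold : ∀ m → orbit m ≡ fold (orbit 0) Φ m
  orbit-fold zero    = refl
  orbit-fold (suc m) = trans (orbit-suc m) (cong Φ (orbit-fold m))

V-order-6 : HasOrder V 6
V-order-6 = s≤s z≤n , V⁶≐I₃ , V^j≢I₃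
  where
  V⁶≐I₃ : matPow V 6 ≐ I₃
  V⁶≐I₃ zero             zero             = refl
  V⁶≐I₃ zero             (suc zero)       = refl
  V⁶≐I₃ zero             (suc (suc zero)) = refl
  V⁶≐I₃ (suc zero)       zero             = refl
  V⁶≐I₃ (suc zero)       (suc zero)       = refl
  V⁶≐I₃ (suc zero)       (suc (suc zero)) = refl
  V⁶≐I₃ (suc (suc zero)) zero             = refl
  V⁶≐I₃ (suc (suc zero)) (suc zero)       = refl
  V⁶≐I₃ (suc (suc zero)) (suc (suc zero)) = refl
  V^j≢I₃ : ∀ j → 0 < j → j < 6 → ¬ (matPow V j ≐ I₃)
  V^j≢I₃ 1 _ _ Vʲ≐I₃ with () ← Vʲ≐I₃ zero zero
  V^j≢I₃ 2 _ _ Vʲ≐I₃ with () ← Vʲ≐I₃ zero zero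
  V^j≢I₃ 3 _ _ Vʲ≐I₃ with () ← Vʲ≐I₃ zero zero
  V^j≢I₃ 4 _ _ Vʲ≐I₃ with () ← Vʲ≐I₃ zero zero
  V^j≢I₃ 5 _ _ Vʲ≐I₃ with () ← Vʲ≐I₃ zero zero
  V^j≢I₃ (suc (suc (suc (suc (suc (suc _)))))) _ (s≤s (s≤s (s≤s (s≤s (s≤s (s≤s ()))))))

proposition5 : HasOrder V 6
    × (∀ (k n : ℕ) → 1 ≤ k → k ≤ 6 →
    sumTo (3 * (k ∸ 1)) (λ i → C i k)
    ≡ sumTo (3 * (k + 6 * n ∸ 1)) (λ i → C i (k + 6 * n)))
proposition5 = V-order-6 , column-sums-periodic
  where
  column-sums-periodic : ∀ (k n : ℕ) → 1 ≤ k → k ≤ 6 →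
    sumTo (3 * (k ∸ 1)) (λ i → C i k) ≡ sumTo (3 * (k + 6 * n ∸ 1)) (λ i → C i (k + 6 * n))
  column-sums-periodic (suc m) n _ _ = cong proj₁ (sym (orbit-periodic m n))
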